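{- Let $G$ be a simple graph with finite vertex set $V$, let $K=\{0,x,y,z\}$ be the Klein four-group viewed as a vector space over $GF(2)$, and let $L=\{L_P: P\subseteq V\}\subseteq K^V$, where $L_P=\bar x(P)+\bar y(N(P))$. Let $F\in\{x,y\}^V$, $F_x=F^{ -1}(x)$, $\widehat F=\{Y\in K^V: Y(v)\in\{0,F(v)\}\text{ for all }v\in V\}$, and let $U$ be the subspace of the $GF(2)$-vector space $\mathcal P(V)$ (addition = symmetric difference) given by $$U=\{P\subseteq F_x:\ |N(v)\cap P|\text{ is even for all }v\in F_x\}.$$ Then $\dim(L\cap\widehat F)=\dim(U)$, dimensions taken over $GF(2)$.
   Context: $K=\{0,x,y,z\}\cong\mathbb{Z}_2\times\mathbb{Z}_2$ via $0\leftrightarrow(0,0)$, $x\leftrightarrow(1,0)$, $y\leftrightarrow(0,1)$, $z\leftrightarrow(1,1)$; $K^V$ (maps $V\to K$) is a $GF(2)$-vector space under pointwise addition. $\bar p\in K^V$ is the constant map with value $p$; for $X\in K^V$ and $Q\subseteq V$, $X(Q)$ is the map equal to $X$ on $Q$ and $0$ off $Q$. $N(v)$ is the set of neighbours of $v$ in $G$ and $N(P)=\sum_{v\in P}N(v)$ (symmetric difference), the set of vertices adjacent to an odd number of vertices of $P$. $L$ and $\widehat F$ are subspaces of $K^V$. -}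

module Defs where

open import Data.Nat using (ℕ; zero; suc)
open import Data.Fin using (Fin; zero; suc)
open import Data.Bool using (Bool; true; false; _xor_; _∧_; if_then_else_)
open import Data.Product using (Σ; ∃; _×_; _,_)
open import Data.Sum using (_⊎_)
open import Relation.Binary.PropositionalEquality using (_≡_)

record SimpleGraph (n : ℕ) : Set where
  field
    adj   : Fin n → Fin n → Bool
    sym   : ∀ u v → adj u v ≡ adj v u
    irrefl : ∀ v → adj v v ≡ false
open SimpleGraph public

data K : Set where
  𝟘 x y z : K

_+K_ : K → K → K
𝟘 +K b = b
a +K 𝟘 = a
x +K x = 𝟘
x +K y = z
x +K z = y
y +K x = z
y +K y = 𝟘
y +K z = x
z +K x = y
z +K y = x
z +K z = 𝟘

Subset : ℕ → Set
Subset n = Fin n → Bool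

parity : ∀ {n} → (Fin n → Bool) → Bool
parity {zero}  f = false
parity {suc n} f = f zero xor parity (λ i → f (suc i))

-- N(P) = Σ_{v∈P} N(v): vertices adjacent to an odd number of vertices of P
Nb : ∀ {n} → SimpleGraph n → Subset n → Subset n
Nb G P w = parity (λ v → P v ∧ adj G v w)

-- X(Q) for constant X = p̄ : equals p on Q and 0 off Q
restrictConst : ∀ {n} → K → Subset n → (Fin n → K)
restrictConst p Q v = if Q v then p else 𝟘

LP : ∀ {n} → SimpleGraph n → Subset n → (Fin n → K)
LP G P v = restrictConst x P v +K restrictConst y (Nb G P) v

InL : ∀ {n} → SimpleGraph n → (Fin n → K) → Set
InL G X = ∃ λ P → ∀ v → X v ≡ LP G P v

InFhat : ∀ {n} → (Fin n → K) → (Fin n → K) → Set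
InFhat F Y = ∀ v → (Y v ≡ 𝟘) ⊎ (Y v ≡ F v)

InU : ∀ {n} → SimpleGraph n → (Fin n → K) → Subset n → Set
InU G F P = (∀ v → P v ≡ true → F v ≡ x)
          × (∀ v → F v ≡ x → parity (λ u → P u ∧ adj G v u) ≡ false)

-- Scalars are GF(2) = Bool, so a linear combination is a sub-sum.

lincomb : {A : Set} → (A → A → A) → A → ∀ {d} → (Fin d → A) → (Fin d → Bool) → A
lincomb _+_ 0a {zero}  b c = 0a
lincomb _+_ 0a {suc d} b c =
  (if c zero then b zero else 0a) + lincomb _+_ 0a (λ i → b (suc i)) (λ i → c (suc i))

record IsBasis {A : Set} (_+_ : A → A → A) (0a : A) (_≈_ : A → A → Set)
               (S : A → Set) {d : ℕ} (b : Fin d → A) : Set where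
  field
    inS         : ∀ i → S (b i)
    spanning    : ∀ X → S X → ∃ λ c → X ≈ lincomb _+_ 0a b c
    independent : ∀ c → lincomb _+_ 0a b c ≈ 0a → ∀ i → c i ≡ false

HasDim : {A : Set} → (A → A → A) → A → (A → A → Set) → (A → Set) → ℕ → Set
HasDim {A} _+_ 0a _≈_ S d = Σ (Fin d → A) λ b → IsBasis _+_ 0a _≈_ S b

_+KV_ : ∀ {n} → (Fin n → K) → (Fin n → K) → (Fin n → K)
(X +KV Y) v = X v +K Y v

0KV : ∀ {n} → Fin n → K
0KV v = 𝟘

_≈KV_ : ∀ {n} → (Fin n → K) → (Fin n → K) → Set
X ≈KV Y = ∀ v → X v ≡ Y v

_+PV_ : ∀ {n} → Subset n → Subset n → Subset n
(P +PV Q) v = P v xor Q v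

0PV : ∀ {n} → Subset n
0PV v = false

_≈PV_ : ∀ {n} → Subset n → Subset n → Set
P ≈PV Q = ∀ v → P v ≡ Q v

{-# OPTIONS --safe #-}
module Submission where

-- P ↦ L_P is a GF(2)-linear map P(V) → K^V with trivial kernel, since the
-- x-coordinate of L_P is P itself.  It maps U onto L ∩ F̂ because the condition
-- L_P(v) ∈ {0, F(v)} reads "v ∉ N(P)", i.e. |N(v) ∩ P| even, when F(v) = x,
-- and "v ∉ P" when F(v) = y.  Hence the image of a basis of U is a basis of
-- L ∩ F̂; a basis of U exists because U is a decidable subspace of GF(2)^V.

open import Defs hiding (sym)
open import Data.Nat using (ℕ; zero; suc)
open import Data.Fin using (Fin; zero; suc)
open import Data.Fin.Properties using (all?)
open import Data.Fin.Subset.Properties using (anySubset?)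
open import Data.Bool using (Bool; true; false; not; _xor_; _∧_; if_then_else_)
open import Data.Bool.Properties
  using (_≟_; ∧-distribʳ-xor; xor-assoc; xor-comm; xor-same; xor-∧-commutativeRing)
open import Algebra.Bundles using (CommutativeRing; CommutativeMonoid)
open import Algebra.Properties.CommutativeSemigroup
  (CommutativeMonoid.commutativeSemigroup (CommutativeRing.+-commutativeMonoid xor-∧-commutativeRing))
  using (interchange)
open import Data.Product using (∃; _×_; _,_; proj₁; proj₂)
open import Data.Sum using (_⊎_; inj₁; inj₂)
open import Data.Vec using (lookup; tabulate)
open import Data.Vec.Properties using (lookup∘tabulate)
open import Data.Vec.Functional using (_∷_; head; tail)
open import Data.Vec.Functional.Properties using (∷-cong)
open import Function using (_∘_)
open import Function.Bundles using (mk⇔)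
open import Relation.Nullary using (Dec; yes; no; ¬_; contradiction)
open import Relation.Nullary.Decidable using (map; _×-dec_; _→-dec_)
open import Relation.Unary using (Decidable)
open import Relation.Binary.Definitions using (Transitive; _Respects_)
open import Relation.Binary.PropositionalEquality
  using (_≡_; _≗_; refl; sym; trans; cong; cong₂; module ≡-Reasoning)

lincomb-homo : {A B : Set} {_+_ : A → A → A} {0a : A} {_⊕_ : B → B → B} {0b : B}
  (f : A → B) → (∀ a a′ → f (a + a′) ≡ f a ⊕ f a′) → f 0a ≡ 0b →
  ∀ {d} (b : Fin d → A) c → f (lincomb _+_ 0a b c) ≡ lincomb _⊕_ 0b (f ∘ b) c
lincomb-homo f f-+ f-0 {zero}  b c = f-0
lincomb-homo {_+_ = _+_} {0a} {_⊕_} {0b} f f-+ f-0 {suc d} b c =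
  trans (f-+ _ _) (cong₂ _⊕_ (f-scale (c zero)) (lincomb-homo f f-+ f-0 (tail b) (tail c)))
  where
  f-scale : ∀ s → f (if s then b zero else 0a) ≡ (if s then f (b zero) else 0b)
  f-scale true  = refl
  f-scale false = f-0

module _ {A B : Set} {_+A_ : A → A → A} {0A : A} {_≈A_ : A → A → Set}
         {_+B_ : B → B → B} {0B : B} {_≈B_ : B → B → Set} (≈B-trans : Transitive _≈B_)
         (f : A → B)
         (f-cong : ∀ {a a′} → a ≈A a′ → f a ≈B f a′)
         (f-lincomb : ∀ {d} (b : Fin d → A) c →
                      f (lincomb _+A_ 0A b c) ≈B lincomb _+B_ 0B (f ∘ b) c)
         (ker-f-trivial : ∀ {a} → f a ≈B 0B → a ≈A 0A)
         {S : A → Set} {T : B → Set}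
         (f-maps : ∀ {a} → S a → T (f a))
         (f-onto : ∀ {X} → T X → ∃ λ a → S a × X ≈B f a) where

  HasDim-image : ∀ {d} → HasDim _+A_ 0A _≈A_ S d → HasDim _+B_ 0B _≈B_ T d
  HasDim-image (b , basis) = f ∘ b , record
    { inS         = f-maps ∘ inS
    ; spanning    = spans
    ; independent = λ c e → independent c (ker-f-trivial (≈B-trans (f-lincomb b c) e))
    }
    where
    open IsBasis basis
    spans : ∀ X → T X → ∃ λ c → X ≈B lincomb _+B_ 0B (f ∘ b) c
    spans X TX with f-onto TX
    ... | a , Sa , X≈fa with spanning a Sa
    ...   | c , a≈bc = c , ≈B-trans X≈fa (≈B-trans (f-cong a≈bc) (f-lincomb b c))

∑ : ∀ {n d} → (Fin d → Subset n) → (Fin d → Bool) → Subset n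
∑ = lincomb _+PV_ 0PV

∑-apply : ∀ {n d} (b : Fin d → Subset n) c v → ∑ b c v ≡ lincomb _xor_ false (λ i → b i v) c
∑-apply b c v = lincomb-homo (λ P → P v) (λ _ _ → refl) refl b c

lincomb-zeros : ∀ {d} (c : Fin d → Bool) → lincomb _xor_ false (λ _ → false) c ≡ false
lincomb-zeros {zero}  c = refl
lincomb-zeros {suc d} c with c zero
... | true  = lincomb-zeros (tail c)
... | false = lincomb-zeros (tail c)

lincomb-unit₀ : ∀ {d} (c : Fin (suc d) → Bool) →
  lincomb _xor_ false (true ∷ λ _ → false) c ≡ head c
lincomb-unit₀ c with c zero
... | true  = cong not (lincomb-zeros (tail c))
... | false = lincomb-zeros (tail c)

xor-cancel : ∀ a b → b xor (a xor b) ≡ a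
xor-cancel a b = begin
  b xor (a xor b)  ≡⟨ cong (b xor_) (xor-comm a b) ⟩
  b xor (b xor a)  ≡⟨ xor-assoc b b a ⟨
  (b xor b) xor a  ≡⟨ cong (_xor a) (xor-same b) ⟩
  a                ∎
  where open ≡-Reasoning

Closed+ : ∀ {n} → (Subset n → Set) → Set
Closed+ S = ∀ {P Q} → S P → S Q → S (P +PV Q)

any-Subset? : ∀ {n} {S : Subset n → Set} → S Respects _≈PV_ → Decidable S → Dec (∃ S)
any-Subset? S-resp S? = map
  (mk⇔ (λ (V , SV) → lookup V , SV)
       (λ (P , SP) → tabulate P , S-resp (sym ∘ lookup∘tabulate P) SP))
  (anySubset? (S? ∘ lookup))

module _ {n} {S : Subset (suc n) → Set} (S-resp : S Respects _≈PV_) (S-closed : Closed+ S)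
         {d} {b : Fin d → Subset n}
         (basis₀ : IsBasis _+PV_ 0PV _≈PV_ (S ∘ (false ∷_)) b) where

  open IsBasis basis₀

  b↑ : Fin d → Subset (suc n)
  b↑ i = false ∷ b i

  ∑↑-head : ∀ c → head (∑ b↑ c) ≡ false
  ∑↑-head c = trans (∑-apply b↑ c zero) (lincomb-zeros c)

  ∑↑-tail : ∀ c → tail (∑ b↑ c) ≗ ∑ b c
  ∑↑-tail c j = trans (∑-apply b↑ c (suc j)) (sym (∑-apply b c j))

  ∑↑-spans : ∀ X → S X → head X ≡ false → ∃ λ c → X ≈PV ∑ b↑ c
  ∑↑-spans X SX X₀ with spanning (tail X) (S-resp (∷-cong X₀ λ _ → refl) SX)
  ... | c , tailX≈ = c , ∷-cong (trans X₀ (sym (∑↑-head c)))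
                                (λ j → trans (tailX≈ j) (sym (∑↑-tail c j)))

  ∑↑-independent : ∀ c → ∑ b↑ c ≈PV 0PV → ∀ i → c i ≡ false
  ∑↑-independent c e = independent c (λ j → trans (sym (∑↑-tail c j)) (e (suc j)))

  IsBasis-lift : (∀ w → ¬ S (true ∷ w)) → IsBasis _+PV_ 0PV _≈PV_ S b↑
  IsBasis-lift ∄w = record
    { inS         = inS
    ; spanning    = spans
    ; independent = ∑↑-independent
    }
    where
    spans : ∀ X → S X → ∃ λ c → X ≈PV ∑ b↑ c
    spans X SX with X zero in X₀
    ... | false = ∑↑-spans X SX X₀
    ... | true  = contradiction (S-resp (∷-cong X₀ λ _ → refl) SX) (∄w (tail X))

  IsBasis-extend : ∀ {w} → S (true ∷ w) → IsBasis _+PV_ 0PV _≈PV_ S ((true ∷ w) ∷ b↑)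
  IsBasis-extend {w} Sw = record
    { inS         = λ { zero → Sw ; (suc i) → inS i }
    ; spanning    = spans
    ; independent = independent′
    }
    where
    spans : ∀ X → S X → ∃ λ c → X ≈PV ∑ ((true ∷ w) ∷ b↑) c
    spans X SX with X zero in X₀
    ... | false with ∑↑-spans X SX X₀
    ...   | c , X≈ = false ∷ c , X≈
    spans X SX | true with ∑↑-spans (X +PV (true ∷ w)) (S-closed SX Sw) (cong (_xor true) X₀)
    ...   | c , X+w≈ = true ∷ c , λ v →
            trans (sym (xor-cancel (X v) ((true ∷ w) v))) (cong ((true ∷ w) v xor_) (X+w≈ v))

    independent′ : ∀ c → ∑ ((true ∷ w) ∷ b↑) c ≈PV 0PV → ∀ i → c i ≡ false
    independent′ c e = λ { zero → c₀≡false ; (suc i) → ∑↑-independent (tail c) rest≈0 i }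
      where
      c₀≡false : head c ≡ false
      c₀≡false = begin
        head c                                      ≡⟨ lincomb-unit₀ c ⟨
        lincomb _xor_ false (true ∷ λ _ → false) c  ≡⟨ ∑-apply ((true ∷ w) ∷ b↑) c zero ⟨
        ∑ ((true ∷ w) ∷ b↑) c zero                  ≡⟨ e zero ⟩
        false                                       ∎
        where open ≡-Reasoning
      rest≈0 : ∑ b↑ (tail c) ≈PV 0PV
      rest≈0 v = trans (cong (λ s → (if s then true ∷ w else 0PV) v xor ∑ b↑ (tail c) v)
                             (sym c₀≡false))
                       (e v)

finiteDimensional : ∀ {n} {S : Subset n → Set} → S Respects _≈PV_ → Closed+ S → Decidable S →
  ∃ (HasDim _+PV_ 0PV _≈PV_ S)
finiteDimensional {zero} _ _ _ = 0 , (λ ()) , record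
  { inS = λ () ; spanning = λ _ _ → (λ ()) , (λ ()) ; independent = λ _ _ () }
finiteDimensional {suc n} {S} S-resp S-closed S?
  with finiteDimensional {S = S ∘ (false ∷_)} (S-resp ∘ ∷-cong refl)
         (λ SP SQ → S-resp (∷-cong refl λ _ → refl) (S-closed SP SQ)) (S? ∘ (false ∷_))
     | any-Subset? (S-resp ∘ ∷-cong refl) (S? ∘ (true ∷_))
... | d , b , basis₀ | no ∄w       = d , _ , IsBasis-lift S-resp S-closed basis₀ (λ w Sw → ∄w (w , Sw))
... | d , b , basis₀ | yes (w , Sw) = suc d , _ , IsBasis-extend S-resp S-closed basis₀ Sw

parity-cong : ∀ {n} {f g : Fin n → Bool} → f ≗ g → parity f ≡ parity g
parity-cong {zero}  e = refl
parity-cong {suc n} e = cong₂ _xor_ (e zero) (parity-cong (e ∘ suc))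

parity-xor : ∀ {n} (f g : Fin n → Bool) → parity (λ i → f i xor g i) ≡ parity f xor parity g
parity-xor {zero}  f g = refl
parity-xor {suc n} f g =
  trans (cong ((f zero xor g zero) xor_) (parity-xor (tail f) (tail g)))
        (interchange (f zero) (g zero) _ _)

parity-false : ∀ {n} → parity {n} (λ _ → false) ≡ false
parity-false {zero}  = refl
parity-false {suc n} = parity-false {n}

parity-∧-xor : ∀ {n} (P Q a : Fin n → Bool) →
  parity (λ u → (P u xor Q u) ∧ a u) ≡ parity (λ u → P u ∧ a u) xor parity (λ u → Q u ∧ a u)
parity-∧-xor P Q a = trans (parity-cong (λ u → ∧-distribʳ-xor (a u) (P u) (Q u)))
                           (parity-xor (λ u → P u ∧ a u) (λ u → Q u ∧ a u))

-- The coordinates K ≅ ℤ₂ × ℤ₂ of the paper: LP G P v is fromBits (P v) (Nb G P v)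
-- by definition.
fromBits : Bool → Bool → K
fromBits p q = (if p then x else 𝟘) +K (if q then y else 𝟘)

fromBits-xor : ∀ p q p′ q′ → fromBits (p xor p′) (q xor q′) ≡ fromBits p q +K fromBits p′ q′
fromBits-xor false false p′    q′    = refl
fromBits-xor false true  false false = refl
fromBits-xor false true  false true  = refl
fromBits-xor false true  true  false = refl
fromBits-xor false true  true  true  = refl
fromBits-xor true  false false false = refl
fromBits-xor true  false false true  = refl
fromBits-xor true  false true  false = refl
fromBits-xor true  false true  true  = refl
fromBits-xor true  true  false false = refl
fromBits-xor true  true  false true  = refl
fromBits-xor true  true  true  false = refl
fromBits-xor true  true  true  true  = refl

fromBits≡𝟘 : ∀ p q → fromBits p q ≡ 𝟘 → p ≡ false
fromBits≡𝟘 false q     _  = refl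
fromBits≡𝟘 true  false ()
fromBits≡𝟘 true  true  ()

fromBits∈F̂⇒ : ∀ {f} → (f ≡ x) ⊎ (f ≡ y) → ∀ p q →
  (fromBits p q ≡ 𝟘) ⊎ (fromBits p q ≡ f) → (p ≡ true → f ≡ x) × (f ≡ x → q ≡ false)
fromBits∈F̂⇒ (inj₁ refl) p     false _        = (λ _ → refl) , (λ _ → refl)
fromBits∈F̂⇒ (inj₁ refl) false true  (inj₁ ())
fromBits∈F̂⇒ (inj₁ refl) false true  (inj₂ ())
fromBits∈F̂⇒ (inj₁ refl) true  true  (inj₁ ())
fromBits∈F̂⇒ (inj₁ refl) true  true  (inj₂ ())
fromBits∈F̂⇒ (inj₂ refl) false q     _        = (λ ()) , (λ ())
fromBits∈F̂⇒ (inj₂ refl) true  false (inj₁ ())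
fromBits∈F̂⇒ (inj₂ refl) true  false (inj₂ ())
fromBits∈F̂⇒ (inj₂ refl) true  true  (inj₁ ())
fromBits∈F̂⇒ (inj₂ refl) true  true  (inj₂ ())

fromBits∈F̂⇐ : ∀ {f} → (f ≡ x) ⊎ (f ≡ y) → ∀ p q →
  (p ≡ true → f ≡ x) × (f ≡ x → q ≡ false) → (fromBits p q ≡ 𝟘) ⊎ (fromBits p q ≡ f)
fromBits∈F̂⇐ _           false false _             = inj₁ refl
fromBits∈F̂⇐ (inj₁ refl) true  false _             = inj₂ refl
fromBits∈F̂⇐ (inj₁ refl) p     true  (_ , x⇒q≡f)   = contradiction (x⇒q≡f refl) λ ()
fromBits∈F̂⇐ (inj₂ refl) false true  _             = inj₂ refl
fromBits∈F̂⇐ (inj₂ refl) true  q     (p⇒y≡x , _)   = contradiction (p⇒y≡x refl) λ ()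

isX? : (a : K) → Dec (a ≡ x)
isX? 𝟘 = no λ ()
isX? x = yes refl
isX? y = no λ ()
isX? z = no λ ()

xor≡true-elim : ∀ {A : Set} a b → (a ≡ true → A) → (b ≡ true → A) → a xor b ≡ true → A
xor≡true-elim true  _ a⇒ _  _ = a⇒ refl
xor≡true-elim false _ _  b⇒ e = b⇒ e

InFhat-resp : ∀ {n} {F : Fin n → K} → InFhat F Respects _≈KV_
InFhat-resp X≈Y X∈F̂ v with X∈F̂ v
... | inj₁ Xv≡𝟘  = inj₁ (trans (sym (X≈Y v)) Xv≡𝟘)
... | inj₂ Xv≡Fv = inj₂ (trans (sym (X≈Y v)) Xv≡Fv)

module _ {n} (G : SimpleGraph n) where

  Nb-sym : ∀ P v → Nb G P v ≡ parity (λ u → P u ∧ adj G v u)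
  Nb-sym P v = parity-cong (λ u → cong (P u ∧_) (SimpleGraph.sym G u v))

  Nb-+ : ∀ P Q w → Nb G (P +PV Q) w ≡ Nb G P w xor Nb G Q w
  Nb-+ P Q w = parity-∧-xor P Q (λ u → adj G u w)

  LP-cong : ∀ {P Q} → P ≈PV Q → LP G P ≈KV LP G Q
  LP-cong P≈Q v = cong₂ fromBits (P≈Q v) (parity-cong (λ u → cong (_∧ adj G u v) (P≈Q u)))

  LP-lincomb : ∀ {d} (b : Fin d → Subset n) c → LP G (∑ b c) ≈KV lincomb _+KV_ 0KV (LP G ∘ b) c
  LP-lincomb b c v =
    trans (lincomb-homo {_⊕_ = _+K_} (λ P → LP G P v) LP-+ (cong (fromBits false) (parity-false {n})) b c)
          (sym (lincomb-homo {_⊕_ = _+K_} (λ X → X v) (λ _ _ → refl) refl (LP G ∘ b) c))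
    where
    LP-+ : ∀ P Q → LP G (P +PV Q) v ≡ LP G P v +K LP G Q v
    LP-+ P Q = trans (cong (fromBits (P v xor Q v)) (Nb-+ P Q v)) (fromBits-xor (P v) (Nb G P v) (Q v) (Nb G Q v))

  LP-ker : ∀ {P} → LP G P ≈KV 0KV → P ≈PV 0PV
  LP-ker {P} LP≈0 v = fromBits≡𝟘 (P v) (Nb G P v) (LP≈0 v)

  module _ {F : Fin n → K} where

    InU-resp : InU G F Respects _≈PV_
    InU-resp P≈Q (P⊆Fx , P-even) =
      (λ v Qv → P⊆Fx v (trans (P≈Q v) Qv)) ,
      (λ v Fv≡x → trans (parity-cong (λ u → cong (_∧ adj G v u) (sym (P≈Q u)))) (P-even v Fv≡x))

    InU-closed : Closed+ (InU G F)
    InU-closed {P} {Q} (P⊆Fx , P-even) (Q⊆Fx , Q-even) =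
      (λ v → xor≡true-elim (P v) (Q v) (P⊆Fx v) (Q⊆Fx v)) ,
      (λ v Fv≡x → trans (parity-∧-xor P Q (adj G v)) (cong₂ _xor_ (P-even v Fv≡x) (Q-even v Fv≡x)))

    InU? : Decidable (InU G F)
    InU? P = all? (λ v → (P v ≟ true) →-dec isX? (F v))
      ×-dec all? (λ v → isX? (F v) →-dec (parity (λ u → P u ∧ adj G v u) ≟ false))

    module _ (F∈xy : ∀ v → (F v ≡ x) ⊎ (F v ≡ y)) where

      InU⇒LP∈F̂ : ∀ {P} → InU G F P → InFhat F (LP G P)
      InU⇒LP∈F̂ {P} (P⊆Fx , P-even) v = fromBits∈F̂⇐ (F∈xy v) (P v) (Nb G P v)
        (P⊆Fx v , λ Fv≡x → trans (Nb-sym P v) (P-even v Fv≡x))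

      LP∈F̂⇒InU : ∀ {P} → InFhat F (LP G P) → InU G F P
      LP∈F̂⇒InU {P} LP∈F̂ =
        (λ v → proj₁ (at v)) , (λ v Fv≡x → trans (sym (Nb-sym P v)) (proj₂ (at v) Fv≡x))
        where
        at : ∀ v → (P v ≡ true → F v ≡ x) × (F v ≡ x → Nb G P v ≡ false)
        at v = fromBits∈F̂⇒ (F∈xy v) (P v) (Nb G P v) (LP∈F̂ v)

lemma4p3 : (n : ℕ) (G : SimpleGraph n) (F : Fin n → K) →
    (∀ v → (F v ≡ x) ⊎ (F v ≡ y)) →
    ∃ λ d →
      HasDim _+KV_ 0KV _≈KV_ (λ X → InL G X × InFhat F X) d
      × HasDim _+PV_ 0PV _≈PV_ (InU G F) d
lemma4p3 n G F F∈xy with finiteDimensional (InU-resp G) (InU-closed G) (InU? G)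
... | d , dimU =
  d , HasDim-image (λ e e′ v → trans (e v) (e′ v)) (LP G) (LP-cong G) (LP-lincomb G) (LP-ker G)
                   U⇒L∩F̂ L∩F̂⇒U dimU
    , dimU
  where
  U⇒L∩F̂ : ∀ {P} → InU G F P → InL G (LP G P) × InFhat F (LP G P)
  U⇒L∩F̂ {P} P∈U = (P , λ _ → refl) , InU⇒LP∈F̂ G F∈xy P∈U

  L∩F̂⇒U : ∀ {X} → InL G X × InFhat F X → ∃ λ P → InU G F P × X ≈KV LP G P
  L∩F̂⇒U ((P , X≈LP) , X∈F̂) = P , LP∈F̂⇒InU G F∈xy (InFhat-resp X≈LP X∈F̂) , X≈LP
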